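{- Let $N:=0.1\cdot 2^{n/2}$ and let $\mathtt{Test}$ be any deterministic, adaptive algorithm that makes $N$ oracle calls to $\mathcal{O}_A$ and $\mathcal{O}_B$. Let $T_{\mathtt{Test}}(A,B)$ be its transcript, i.e. the sequence (first query to one of the oracles, response received), ..., ($N$-th query to one of the oracles, response received). Then \[\mathrm{dist}_{\mathrm{TV}}\big(T_{\mathtt{Test}}(\mathbf{A}_{\mathrm{yes}},\mathbf{B}_{\mathrm{yes}}),\,T_{\mathtt{Test}}(\mathbf{A}_{\mathrm{no}},\mathbf{B}_{\mathrm{no}})\big)\le 0.02,\] where $(\mathbf{A}_{\mathrm{yes}},\mathbf{B}_{\mathrm{yes}})\sim\mathcal{D}_{\mathrm{yes}}$ and $(\mathbf{A}_{\mathrm{no}},\mathbf{B}_{\mathrm{no}})\sim\mathcal{D}_{\mathrm{no}}$.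
   Context: For $A\subseteq\mathbb{F}_2^n$, $\mathcal{O}_A:\mathbb{F}_2^n\to\{0,1\}$ is its membership oracle. A draw $(\mathbf{A},\mathbf{B})\sim\mathcal{D}_{\mathrm{yes}}$: $\mathbf{A}\subseteq\mathbb{F}_2^n$ includes each element independently with probability $1/2$, and $\mathbf{B}=\mathbf{A}+\mathbf{s}=\{a+\mathbf{s}:a\in\mathbf{A}\}$ for $\mathbf{s}$ uniform in $\mathbb{F}_2^n$ (independent of $\mathbf{A}$). A draw $(\mathbf{A},\mathbf{B})\sim\mathcal{D}_{\mathrm{no}}$: $\mathbf{A}$ and $\mathbf{B}$ are independent, each including every element of $\mathbb{F}_2^n$ independently with probability $1/2$. $\mathrm{dist}_{\mathrm{TV}}$ denotes total variation distance. -}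

module Defs where

open import Data.Bool using (Bool; true; false; _xor_; if_then_else_)
open import Data.Bool.Properties using () renaming (_≟_ to _≟𝔹_)
open import Data.Nat as ℕ using (ℕ; zero; suc; _^_)
open import Data.Nat.Properties using (m^n≢0)
open import Data.Integer using (+_)
open import Data.Rational using (ℚ; _/_; ∣_∣; _+_; _-_; _*_; 0ℚ; ½)
open import Data.Product using (_×_; _,_)
open import Data.Vec using (Vec; []; _∷_; zipWith)
open import Data.List using (List; []; _∷_; _++_; concatMap; map; foldr; length)
open import Relation.Nullary.Decidable using (does)
open import Data.Vec.Properties using () renaming (≡-dec to vec-≡-dec)
open import Data.Product.Properties using () renaming (≡-dec to ×-≡-dec)
open import Relation.Binary.PropositionalEquality using (_≡_)
open import Relation.Binary.Definitions using (DecidableEquality)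

-- Points of 𝔽₂ⁿ (Bool = 𝔽₂, xor = addition)
Pt : ℕ → Set
Pt n = Vec Bool n

_⊕_ : ∀ {n} → Pt n → Pt n → Pt n
x ⊕ y = zipWith _xor_ x y

Subset : ℕ → Set
Subset n = Pt n → Bool

-- A + s = { a + s : a ∈ A };  x ∈ A + s  iff  x + s ∈ A  (characteristic 2)
shift : ∀ {n} → Subset n → Pt n → Subset n
shift A s x = A (x ⊕ s)

-- A query: which oracle (false = 𝒪_A, true = 𝒪_B) and the queried point
Query : ℕ → Set
Query n = Bool × Pt n

answer : ∀ {n} → Query n → Subset n → Subset n → Bool
answer (false , x) A B = A x
answer (true  , x) A B = B x

-- A deterministic adaptive algorithm making exactly k oracle calls:
-- a decision tree whose next query depends on all previous answers.
data Algo (n : ℕ) : ℕ → Set where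
  done : Algo n zero
  ask  : ∀ {k} → Query n → (Bool → Algo n k) → Algo n (suc k)

Transcript : ℕ → ℕ → Set
Transcript n k = Vec (Query n × Bool) k

run : ∀ {n k} → Algo n k → Subset n → Subset n → Transcript n k
run done        A B = []
run (ask q f)   A B = let r = answer q A B in (q , r) ∷ run (f r) A B

allBool : List Bool
allBool = false ∷ true ∷ []

allVec : ∀ {a} {X : Set a} → List X → (k : ℕ) → List (Vec X k)
allVec xs zero    = [] ∷ []
allVec xs (suc k) = concatMap (λ x → map (x ∷_) (allVec xs k)) xs

allPt : (n : ℕ) → List (Pt n)
allPt n = allVec allBool n

-- all 2^(2^n) subsets of 𝔽₂ⁿ, each exactly once
allSubset : (n : ℕ) → List (Subset n)
allSubset zero    = (λ _ → false) ∷ (λ _ → true) ∷ []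
allSubset (suc n) =
  concatMap (λ f → map (λ g → λ { (false ∷ v) → f v ; (true ∷ v) → g v })
                        (allSubset n))
            (allSubset n)

allQuery : (n : ℕ) → List (Query n)
allQuery n = concatMap (λ b → map (b ,_) (allPt n)) allBool

allTranscript : (n k : ℕ) → List (Transcript n k)
allTranscript n k =
  allVec (concatMap (λ q → map (q ,_) allBool) (allQuery n)) k

_≟T_ : ∀ {n k} → DecidableEquality (Transcript n k)
_≟T_ = vec-≡-dec (×-≡-dec (×-≡-dec _≟𝔹_ (vec-≡-dec _≟𝔹_)) _≟𝔹_)

countL : ∀ {X : Set} → (X → Bool) → List X → ℕ
countL p []       = 0
countL p (x ∷ xs) = if p x then suc (countL p xs) else countL p xs

sumℚ : ∀ {X : Set} → (X → ℚ) → List X → ℚ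
sumℚ f = foldr (λ x acc → f x + acc) 0ℚ

sumℕ : ∀ {X : Set} → (X → ℕ) → List X → ℕ
sumℕ f = foldr (λ x acc → f x ℕ.+ acc) 0

-- Pr over D_yes: A uniform (each element independently w.p. 1/2, i.e. uniform
-- over all 2^(2^n) subsets), s uniform in 𝔽₂ⁿ independent of A, B = A + s.
probYes : ∀ {n k} → Algo n k → Transcript n k → ℚ
probYes {n} alg t =
  _/_ (+ sumℕ (λ A → countL (λ s → does (run alg A (shift A s) ≟T t)) (allPt n))
              (allSubset n))
      (2 ^ (2 ^ n ℕ.+ n)) {{m^n≢0 2 (2 ^ n ℕ.+ n)}}

-- Pr over D_no: A, B independent uniform subsets.
probNo : ∀ {n k} → Algo n k → Transcript n k → ℚ
probNo {n} alg t =
  _/_ (+ sumℕ (λ A → countL (λ B → does (run alg A B ≟T t)) (allSubset n))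
              (allSubset n))
      (2 ^ (2 ^ n ℕ.+ 2 ^ n)) {{m^n≢0 2 (2 ^ n ℕ.+ 2 ^ n)}}

distTV-transcript : ∀ {n k} → Algo n k → ℚ
distTV-transcript {n} {k} alg =
  ½ * sumℚ (λ t → ∣ probYes alg t - probNo alg t ∣) (allTranscript n k)

-- Fix a transcript t that the algorithm can produce, and let L_A, L_B be the
-- (point, answer) pairs it records for the two oracles. Under D_no, t occurs for
-- #Sat(L_A)·#Sat(L_B) pairs (A, B); under D_yes, for Σ_s #Sat(L_A ∪ (L_B + s))
-- pairs (A, s), where #Sat counts subsets of 𝔽₂ⁿ meeting the constraints.
-- Constraints at disjoint point sets are independent and #Sat is translation
-- invariant, so every s with L_A ∩ (L_B + s) = ∅ contributes #Sat(L_A)·#Sat(L_B)/2^(2ⁿ);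
-- at most |L_A|·|L_B| ≤ N² shifts s cause a collision. Hence
-- Pr_yes[t] ≥ (1 − N²/2ⁿ)·Pr_no[t] for every t, and since both distributions
-- have total mass 1 the total variation distance is at most N²/2ⁿ ≤ 1/100.
module Submission where

open import Defs
open import Data.Bool using (Bool; true; false; _∧_; _xor_; not; if_then_else_; T)
open import Data.Bool.Properties using (∧-assoc; ∧-comm; ∧-zeroʳ; not-involutive; T-∧) renaming (_≟_ to _≟𝔹_)
open import Data.Integer as ℤ using (+_; _⊖_)
import Data.Integer.Properties as ℤ
open import Data.List using (List; []; _∷_; _++_; concatMap; map; length)
open import Data.List.Properties using (++-identityʳ)
open import Data.Nat using (ℕ; zero; suc; _+_; _*_; _∸_; _^_; ∣_-_∣; _≤_; _<_; z≤n; s≤s; NonZero)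
open import Data.Nat.Properties
open import Data.Nat.Solver using (module +-*-Solver)
open import Data.Product using (_×_; _,_; map₁)
open import Data.Product.Properties using (,-injective) renaming (≡-dec to ×-≡-dec)
open import Data.Rational as ℚ using (ℚ; _/_; ½; toℚᵘ) renaming (_≤_ to _≤ℚ_)
import Data.Rational.Properties as ℚ
open import Data.Rational.Unnormalised as ℚᵘ using (mkℚᵘ; *≡*; *≤*)
import Data.Rational.Unnormalised.Properties as ℚᵘ
open import Data.Vec using ([]; _∷_)
open import Data.Vec.Properties using () renaming (≡-dec to vec-≡-dec)
open import Function using (_∘_)
open import Function.Bundles using (Equivalence)
open import Relation.Binary.Definitions using (DecidableEquality)
open import Relation.Binary.PropositionalEquality
open import Relation.Nullary.Decidable using (does; does-≡; yes; no; map′; _×-dec_)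

open +-*-Solver using (solve; _:*_; _:+_; _:=_; con)
open import Algebra.Properties.CommutativeSemigroup +-commutativeSemigroup using () renaming (interchange to +-interchange)
open import Algebra.Properties.CommutativeSemigroup *-commutativeSemigroup using () renaming (interchange to *-interchange)

⟦_⟧ : Bool → ℕ
⟦ true ⟧  = 1
⟦ false ⟧ = 0

⟦∧⟧ : ∀ a b → ⟦ a ∧ b ⟧ ≡ ⟦ a ⟧ * ⟦ b ⟧
⟦∧⟧ true  b = sym (+-identityʳ ⟦ b ⟧)
⟦∧⟧ false b = refl

⟦b⟧+⟦not-b⟧≡1 : ∀ b → ⟦ b ⟧ + ⟦ not b ⟧ ≡ 1
⟦b⟧+⟦not-b⟧≡1 true  = refl
⟦b⟧+⟦not-b⟧≡1 false = refl

⟦not-∧⟧≤ : ∀ a b → ⟦ not (a ∧ b) ⟧ ≤ ⟦ not a ⟧ + ⟦ not b ⟧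
⟦not-∧⟧≤ true  b = ≤-refl
⟦not-∧⟧≤ false b = s≤s z≤n

module _ {X : Set} where

  countL≡sum : (p : X → Bool) (xs : List X) → countL p xs ≡ sumℕ (⟦_⟧ ∘ p) xs
  countL≡sum p []       = refl
  countL≡sum p (x ∷ xs) with p x
  ... | true  = cong suc (countL≡sum p xs)
  ... | false = countL≡sum p xs

  sum-cong : {f g : X → ℕ} → (∀ x → f x ≡ g x) → ∀ xs → sumℕ f xs ≡ sumℕ g xs
  sum-cong f≗g []       = refl
  sum-cong f≗g (x ∷ xs) = cong₂ _+_ (f≗g x) (sum-cong f≗g xs)

  sum-mono : {f g : X → ℕ} → (∀ x → f x ≤ g x) → ∀ xs → sumℕ f xs ≤ sumℕ g xs
  sum-mono f≤g []       = z≤n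
  sum-mono f≤g (x ∷ xs) = +-mono-≤ (f≤g x) (sum-mono f≤g xs)

  sum-++ : ∀ f (xs ys : List X) → sumℕ f (xs ++ ys) ≡ sumℕ f xs + sumℕ f ys
  sum-++ f []       ys = refl
  sum-++ f (x ∷ xs) ys = trans (cong (_+_ (f x)) (sum-++ f xs ys)) (sym (+-assoc (f x) _ _))

  sum-+ : ∀ f g (xs : List X) → sumℕ (λ x → f x + g x) xs ≡ sumℕ f xs + sumℕ g xs
  sum-+ f g []       = refl
  sum-+ f g (x ∷ xs) = trans (cong (_+_ (f x + g x)) (sum-+ f g xs))
                             (+-interchange (f x) (g x) (sumℕ f xs) (sumℕ g xs))

  sum-*ˡ : ∀ c f (xs : List X) → sumℕ (λ x → c * f x) xs ≡ c * sumℕ f xs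
  sum-*ˡ c f []       = sym (*-zeroʳ c)
  sum-*ˡ c f (x ∷ xs) = trans (cong (_+_ (c * f x)) (sum-*ˡ c f xs)) (sym (*-distribˡ-+ c (f x) _))

  sum-*ʳ : ∀ c f (xs : List X) → sumℕ (λ x → f x * c) xs ≡ sumℕ f xs * c
  sum-*ʳ c f xs = trans (sum-cong (λ x → *-comm (f x) c) xs) (trans (sum-*ˡ c f xs) (*-comm c _))

  sum-const : ∀ c (xs : List X) → sumℕ (λ _ → c) xs ≡ length xs * c
  sum-const c []       = refl
  sum-const c (x ∷ xs) = cong (_+_ c) (sum-const c xs)

  sum-0 : (xs : List X) → sumℕ (λ _ → 0) xs ≡ 0
  sum-0 xs = trans (sum-const 0 xs) (*-zeroʳ (length xs))

module _ {X Y : Set} where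

  sum-swap : ∀ (f : X → Y → ℕ) xs ys →
             sumℕ (λ x → sumℕ (f x) ys) xs ≡ sumℕ (λ y → sumℕ (λ x → f x y) xs) ys
  sum-swap f []       ys = sym (sum-0 ys)
  sum-swap f (x ∷ xs) ys = trans (cong (_+_ (sumℕ (f x) ys)) (sum-swap f xs ys))
                                 (sym (sum-+ (f x) _ ys))

module _ {X Y Z : Set} where

  sum-concatMap-map : ∀ (h : X → Y → Z) f (a : X → ℕ) (b : Y → ℕ) →
                      (∀ x y → f (h x y) ≡ a x * b y) → ∀ xs ys →
                      sumℕ f (concatMap (λ x → map (h x) ys) xs) ≡ sumℕ a xs * sumℕ b ys
  sum-concatMap-map h f a b f≡a*b []       ys = refl
  sum-concatMap-map h f a b f≡a*b (x ∷ xs) ys = begin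
    sumℕ f (map (h x) ys ++ concatMap (λ x → map (h x) ys) xs)
      ≡⟨ sum-++ f (map (h x) ys) _ ⟩
    sumℕ f (map (h x) ys) + sumℕ f (concatMap (λ x → map (h x) ys) xs)
      ≡⟨ cong₂ _+_ (sum-map ys) (sum-concatMap-map h f a b f≡a*b xs ys) ⟩
    a x * sumℕ b ys + sumℕ a xs * sumℕ b ys
      ≡⟨ *-distribʳ-+ (sumℕ b ys) (a x) (sumℕ a xs) ⟨
    sumℕ a (x ∷ xs) * sumℕ b ys ∎
    where
    open ≡-Reasoning
    sum-map : ∀ ys → sumℕ f (map (h x) ys) ≡ a x * sumℕ b ys
    sum-map []       = sym (*-zeroʳ (a x))
    sum-map (y ∷ ys) = trans (cong₂ _+_ (f≡a*b x y) (sum-map ys)) (sym (*-distribˡ-+ (a x) (b y) _))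

record Enumerates {X : Set} (_≟_ : DecidableEquality X) (xs : List X) : Set where
  field
    once : ∀ x → sumℕ (λ y → ⟦ does (x ≟ y) ⟧) xs ≡ 1
open Enumerates

allBool-enumerates : Enumerates _≟𝔹_ allBool
allBool-enumerates .once false = refl
allBool-enumerates .once true  = refl

module _ {X Y : Set} {_≟X_ : DecidableEquality X} {_≟Y_ : DecidableEquality Y} where

  does-≟-, : (_≟_ : DecidableEquality (X × Y)) (x x′ : X) (y y′ : Y) →
             does ((x , y) ≟ (x′ , y′)) ≡ does (x ≟X x′) ∧ does (y ≟Y y′)
  does-≟-, _≟_ x x′ y y′ =
    does-≡ ((x , y) ≟ (x′ , y′)) (map′ (λ (p , q) → cong₂ _,_ p q) ,-injective (x ≟X x′ ×-dec y ≟Y y′))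

  ×-enumerates : (_≟_ : DecidableEquality (X × Y)) {xs : List X} {ys : List Y} →
                 Enumerates _≟X_ xs → Enumerates _≟Y_ ys →
                 Enumerates _≟_ (concatMap (λ x → map (x ,_) ys) xs)
  ×-enumerates _≟_ {xs} {ys} enum-xs enum-ys .once (x , y) =
    trans (sum-concatMap-map _,_ _ _ _ (λ x′ y′ → trans (cong ⟦_⟧ (does-≟-, _≟_ x x′ y y′)) (⟦∧⟧ (does (x ≟X x′)) _))
                             xs ys)
          (cong₂ _*_ (enum-xs .once x) (enum-ys .once y))

allVec-enumerates : ∀ {X : Set} {_≟_ : DecidableEquality X} {xs : List X} →
                    Enumerates _≟_ xs → ∀ k → Enumerates (vec-≡-dec _≟_) (allVec xs k)
allVec-enumerates enum zero    .once []      = refl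
allVec-enumerates {_≟_ = _≟_} {xs} enum (suc k) .once (x ∷ v) =
  trans (sum-concatMap-map _∷_ _ _ _ (λ x′ v′ → ⟦∧⟧ (does (x ≟ x′)) _) xs (allVec xs k))
        (cong₂ _*_ (enum .once x) (allVec-enumerates enum k .once v))

length≡sum-1 : ∀ {X : Set} (xs : List X) → length xs ≡ sumℕ (λ _ → 1) xs
length≡sum-1 xs = sym (trans (sum-const 1 xs) (*-identityʳ (length xs)))

sum-fibres : ∀ {W X Y : Set} {_≟_ : DecidableEquality Y} {ys : List Y} → Enumerates _≟_ ys →
             (g : W → X → Y) (ws : List W) (xs : List X) →
             sumℕ (λ y → sumℕ (λ w → countL (λ x → does (g w x ≟ y)) xs) ws) ys ≡ length ws * length xs
sum-fibres {_≟_ = _≟_} {ys} enum g ws xs = begin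
  sumℕ (λ y → sumℕ (λ w → countL (λ x → does (g w x ≟ y)) xs) ws) ys
    ≡⟨ sum-swap (λ y w → countL (λ x → does (g w x ≟ y)) xs) ys ws ⟩
  sumℕ (λ w → sumℕ (λ y → countL (λ x → does (g w x ≟ y)) xs) ys) ws
    ≡⟨ sum-cong (λ w → sum-cong (λ y → countL≡sum _ xs) ys) ws ⟩
  sumℕ (λ w → sumℕ (λ y → sumℕ (λ x → ⟦ does (g w x ≟ y) ⟧) xs) ys) ws
    ≡⟨ sum-cong (λ w → sum-swap (λ y x → ⟦ does (g w x ≟ y) ⟧) ys xs) ws ⟩
  sumℕ (λ w → sumℕ (λ x → sumℕ (λ y → ⟦ does (g w x ≟ y) ⟧) ys) xs) ws
    ≡⟨ sum-cong (λ w → sum-cong (enum .once ∘ g w) xs) ws ⟩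
  sumℕ (λ _ → sumℕ (λ _ → 1) xs) ws
    ≡⟨ sum-const _ ws ⟩
  length ws * sumℕ (λ _ → 1) xs
    ≡⟨ cong (length ws *_) (length≡sum-1 xs) ⟨
  length ws * length xs ∎
  where open ≡-Reasoning

allTranscript-enumerates : ∀ n k → Enumerates _≟T_ (allTranscript n k)
allTranscript-enumerates n k =
  allVec-enumerates (×-enumerates _ query-enum allBool-enumerates) k
  where
  pt-enum : Enumerates (vec-≡-dec _≟𝔹_) (allPt n)
  pt-enum = allVec-enumerates allBool-enumerates n
  query-enum : Enumerates (×-≡-dec _≟𝔹_ (vec-≡-dec _≟𝔹_)) (allQuery n)
  query-enum = ×-enumerates _ allBool-enumerates pt-enum

length-concatMap-map : ∀ {X Y Z : Set} (h : X → Y → Z) xs ys →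
                       length (concatMap (λ x → map (h x) ys) xs) ≡ length xs * length ys
length-concatMap-map h xs ys = begin
  length (concatMap (λ x → map (h x) ys) xs)
    ≡⟨ length≡sum-1 (concatMap (λ x → map (h x) ys) xs) ⟩
  sumℕ (λ _ → 1) (concatMap (λ x → map (h x) ys) xs)
    ≡⟨ sum-concatMap-map h _ (λ _ → 1) (λ _ → 1) (λ _ _ → refl) xs ys ⟩
  sumℕ (λ _ → 1) xs * sumℕ (λ _ → 1) ys
    ≡⟨ cong₂ _*_ (length≡sum-1 xs) (length≡sum-1 ys) ⟨
  length xs * length ys ∎
  where open ≡-Reasoning
length-allPt : ∀ n → length (allPt n) ≡ 2 ^ n
length-allPt zero    = refl
length-allPt (suc n) = trans (length-concatMap-map _∷_ allBool (allPt n)) (cong (2 *_) (length-allPt n))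

length-allSubset : ∀ n → length (allSubset n) ≡ 2 ^ 2 ^ n
length-allSubset zero    = refl
length-allSubset (suc n) = begin
  length (allSubset (suc n))
    ≡⟨ length-concatMap-map _ (allSubset n) (allSubset n) ⟩
  length (allSubset n) * length (allSubset n)
    ≡⟨ cong₂ _*_ (length-allSubset n) (length-allSubset n) ⟩
  2 ^ 2 ^ n * 2 ^ 2 ^ n
    ≡⟨ ^-distribˡ-+-* 2 (2 ^ n) (2 ^ n) ⟨
  2 ^ (2 ^ n + 2 ^ n)
    ≡⟨ cong (λ m → 2 ^ (2 ^ n + m)) (+-identityʳ (2 ^ n)) ⟨
  2 ^ 2 ^ suc n ∎
  where open ≡-Reasoning

Constraints : ℕ → Set
Constraints n = List (Pt n × Bool)

infix 4 _≟ₚ_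
_≟ₚ_ : ∀ {n} → DecidableEquality (Pt n)
_≟ₚ_ = vec-≡-dec _≟𝔹_

_⊨_ : ∀ {n} → Subset n → Constraints n → Bool
A ⊨ []            = true
A ⊨ ((x , r) ∷ L) = does (A x ≟𝔹 r) ∧ A ⊨ L

#Sat : ∀ n → Constraints n → ℕ
#Sat n L = sumℕ (λ A → ⟦ A ⊨ L ⟧) (allSubset n)

#Sat-[] : ∀ n → #Sat n [] ≡ 2 ^ 2 ^ n
#Sat-[] n = trans (sum-const 1 (allSubset n)) (trans (*-identityʳ _) (length-allSubset n))

⊨-++ : ∀ {n} (A : Subset n) L₁ L₂ → A ⊨ (L₁ ++ L₂) ≡ A ⊨ L₁ ∧ A ⊨ L₂
⊨-++ A []              L₂ = refl
⊨-++ A ((x , r) ∷ L₁) L₂ =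
  trans (cong (does (A x ≟𝔹 r) ∧_) (⊨-++ A L₁ L₂)) (sym (∧-assoc (does (A x ≟𝔹 r)) _ _))

∧-swap : ∀ a b c → a ∧ (b ∧ c) ≡ b ∧ (a ∧ c)
∧-swap a b c = trans (sym (∧-assoc a b c)) (trans (cong (_∧ c) (∧-comm a b)) (∧-assoc b a c))

restrict : ∀ {n} → Bool → Constraints (suc n) → Constraints n
restrict b []                  = []
restrict b ((c ∷ v , r) ∷ L) = if does (b ≟𝔹 c) then (v , r) ∷ restrict b L else restrict b L

⊨-glue : ∀ {n} (f g : Subset n) (h : Subset (suc n)) →
         (∀ v → h (false ∷ v) ≡ f v) → (∀ v → h (true ∷ v) ≡ g v) →
         ∀ L → h ⊨ L ≡ f ⊨ restrict false L ∧ g ⊨ restrict true L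
⊨-glue f g h h₀ h₁ [] = refl
⊨-glue f g h h₀ h₁ ((false ∷ v , r) ∷ L) rewrite h₀ v | ⊨-glue f g h h₀ h₁ L =
  sym (∧-assoc (does (f v ≟𝔹 r)) _ _)
⊨-glue f g h h₀ h₁ ((true ∷ v , r) ∷ L) rewrite h₁ v | ⊨-glue f g h h₀ h₁ L =
  ∧-swap (does (g v ≟𝔹 r)) (f ⊨ restrict false L) (g ⊨ restrict true L)

#Sat-suc : ∀ n L → #Sat (suc n) L ≡ #Sat n (restrict false L) * #Sat n (restrict true L)
#Sat-suc n L = sum-concatMap-map _ _ _ _ glue (allSubset n) (allSubset n)
  where
  glue : ∀ f g → ⟦ _ ⊨ L ⟧ ≡ ⟦ f ⊨ restrict false L ⟧ * ⟦ g ⊨ restrict true L ⟧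
  glue f g = trans (cong ⟦_⟧ (⊨-glue f g _ (λ _ → refl) (λ _ → refl) L)) (⟦∧⟧ (f ⊨ restrict false L) _)

avoids : ∀ {n} → Pt n → Constraints n → Bool
avoids x []            = true
avoids x ((y , _) ∷ L) = not (does (x ≟ₚ y)) ∧ avoids x L

disjoint : ∀ {n} → Constraints n → Constraints n → Bool
disjoint []            L₂ = true
disjoint ((x , _) ∷ L₁) L₂ = avoids x L₂ ∧ disjoint L₁ L₂

restrict-++ : ∀ {n} b (L₁ L₂ : Constraints (suc n)) → restrict b (L₁ ++ L₂) ≡ restrict b L₁ ++ restrict b L₂
restrict-++ b []                   L₂ = refl
restrict-++ b ((c ∷ v , r) ∷ L₁) L₂ with does (b ≟𝔹 c)
... | true  = cong ((v , r) ∷_) (restrict-++ b L₁ L₂)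
... | false = restrict-++ b L₁ L₂

∧-monoʳ : ∀ a {b c} → (T b → T c) → T (a ∧ b) → T (a ∧ c)
∧-monoʳ true  b⇒c = b⇒c

avoids-restrict : ∀ {n} b (x : Pt n) L → T (avoids (b ∷ x) L) → T (avoids x (restrict b L))
avoids-restrict b     x []                    _ = _
avoids-restrict false x ((false ∷ y , _) ∷ L) h = ∧-monoʳ (not (does (x ≟ₚ y))) (avoids-restrict false x L) h
avoids-restrict false x ((true  ∷ y , _) ∷ L) h = avoids-restrict false x L h
avoids-restrict true  x ((false ∷ y , _) ∷ L) h = avoids-restrict true x L h
avoids-restrict true  x ((true  ∷ y , _) ∷ L) h = ∧-monoʳ (not (does (x ≟ₚ y))) (avoids-restrict true x L) h

disjoint-restrict : ∀ {n} b (L₁ L₂ : Constraints (suc n)) →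
                    T (disjoint L₁ L₂) → T (disjoint (restrict b L₁) (restrict b L₂))
disjoint-restrict b [] L₂ _ = _
disjoint-restrict b ((c ∷ x , r) ∷ L₁) L₂ h with b ≟𝔹 c | Equivalence.to T-∧ h
... | no _     | _ , h′      = disjoint-restrict b L₁ L₂ h′
... | yes refl | x∉L₂ , h′ = Equivalence.from T-∧ (avoids-restrict b x L₂ x∉L₂ , disjoint-restrict b L₁ L₂ h′)

-- Independence, multiplied through by #Sat n [] = 2^(2ⁿ) to stay in ℕ.
#Sat-++ : ∀ n (L₁ L₂ : Constraints n) → T (disjoint L₁ L₂) →
          #Sat n (L₁ ++ L₂) * #Sat n [] ≡ #Sat n L₁ * #Sat n L₂
#Sat-++ zero    []       L₂ _ = *-comm (#Sat zero L₂) 2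
#Sat-++ zero    (c ∷ L₁) [] _ = cong (λ L → #Sat zero L * 2) (++-identityʳ (c ∷ L₁))
#Sat-++ zero    (([] , _) ∷ L₁) (([] , _) ∷ L₂) ()
#Sat-++ (suc n) L₁ L₂ L₁#L₂ = begin
  #Sat (suc n) (L₁ ++ L₂) * #Sat (suc n) []
    ≡⟨ cong₂ _*_ (#Sat-suc n (L₁ ++ L₂)) (#Sat-suc n []) ⟩
  (N false (L₁ ++ L₂) * N true (L₁ ++ L₂)) * (N₀ * N₀)
    ≡⟨ *-interchange (N false (L₁ ++ L₂)) (N true (L₁ ++ L₂)) N₀ N₀ ⟩
  (N false (L₁ ++ L₂) * N₀) * (N true (L₁ ++ L₂) * N₀)
    ≡⟨ cong₂ _*_ (half false) (half true) ⟩
  (N false L₁ * N false L₂) * (N true L₁ * N true L₂)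
    ≡⟨ *-interchange (N false L₁) (N false L₂) (N true L₁) (N true L₂) ⟩
  (N false L₁ * N true L₁) * (N false L₂ * N true L₂)
    ≡⟨ cong₂ _*_ (#Sat-suc n L₁) (#Sat-suc n L₂) ⟨
  #Sat (suc n) L₁ * #Sat (suc n) L₂ ∎
  where
  open ≡-Reasoning
  N : Bool → Constraints (suc n) → ℕ
  N b L = #Sat n (restrict b L)
  N₀ : ℕ
  N₀ = #Sat n []
  half : ∀ b → N b (L₁ ++ L₂) * N₀ ≡ N b L₁ * N b L₂
  half b = trans (cong (λ L → #Sat n L * N₀) (restrict-++ b L₁ L₂))
                 (#Sat-++ n (restrict b L₁) (restrict b L₂) (disjoint-restrict b L₁ L₂ L₁#L₂))

translate : ∀ {n} → Pt n → Constraints n → Constraints n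
translate s = map (map₁ (_⊕ s))

⊨-translate : ∀ {n} (A : Subset n) s L → shift A s ⊨ L ≡ A ⊨ translate s L
⊨-translate A s []            = refl
⊨-translate A s ((x , r) ∷ L) = cong (does (A (x ⊕ s) ≟𝔹 r) ∧_) (⊨-translate A s L)

does-≟-xor : ∀ b d c → does (b ≟𝔹 d xor c) ≡ does (b xor c ≟𝔹 d)
does-≟-xor false false false = refl
does-≟-xor false false true  = refl
does-≟-xor false true  false = refl
does-≟-xor false true  true  = refl
does-≟-xor true  false false = refl
does-≟-xor true  false true  = refl
does-≟-xor true  true  false = refl
does-≟-xor true  true  true  = refl

restrict-translate : ∀ {n} b c (s : Pt n) L →
                     restrict b (translate (c ∷ s) L) ≡ translate s (restrict (b xor c) L)
restrict-translate b c s [] = refl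
restrict-translate b c s ((d ∷ x , r) ∷ L)
  rewrite does-≟-xor b d c with does (b xor c ≟𝔹 d)
... | true  = cong ((x ⊕ s , r) ∷_) (restrict-translate b c s L)
... | false = restrict-translate b c s L

#Sat-translate : ∀ n (s : Pt n) L → #Sat n (translate s L) ≡ #Sat n L
#Sat-translate zero    []      L = cong (#Sat zero) (translate-[] L)
  where
  translate-[] : ∀ L → translate [] L ≡ L
  translate-[] []                  = refl
  translate-[] (([] , r) ∷ L) = cong (([] , r) ∷_) (translate-[] L)
#Sat-translate (suc n) (c ∷ s) L = begin
  #Sat (suc n) (translate (c ∷ s) L)
    ≡⟨ #Sat-suc n (translate (c ∷ s) L) ⟩
  N false * N true
    ≡⟨ cong₂ _*_ (half false) (half true) ⟩
  #Sat n (restrict (false xor c) L) * #Sat n (restrict (true xor c) L)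
    ≡⟨ halves-swap c ⟩
  #Sat n (restrict false L) * #Sat n (restrict true L)
    ≡⟨ #Sat-suc n L ⟨
  #Sat (suc n) L ∎
  where
  open ≡-Reasoning
  N : Bool → ℕ
  N b = #Sat n (restrict b (translate (c ∷ s) L))
  half : ∀ b → N b ≡ #Sat n (restrict (b xor c) L)
  half b = trans (cong (#Sat n) (restrict-translate b c s L)) (#Sat-translate n s (restrict (b xor c) L))
  halves-swap : ∀ c → #Sat n (restrict (false xor c) L) * #Sat n (restrict (true xor c) L)
                    ≡ #Sat n (restrict false L) * #Sat n (restrict true L)
  halves-swap false = refl
  halves-swap true  = *-comm (#Sat n (restrict true L)) _

_≟Q_ : ∀ {n} → DecidableEquality (Query n)
_≟Q_ = ×-≡-dec _≟𝔹_ _≟ₚ_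

consistent : ∀ {n k} → Algo n k → Transcript n k → Bool
consistent done      []              = true
consistent (ask q f) ((q′ , r) ∷ t) = does (q ≟Q q′) ∧ consistent (f r) t

answersA answersB : ∀ {n k} → Transcript n k → Constraints n
answersA []                       = []
answersA (((false , x) , r) ∷ t) = (x , r) ∷ answersA t
answersA (((true  , x) , r) ∷ t) = answersA t
answersB []                       = []
answersB (((false , x) , r) ∷ t) = answersB t
answersB (((true  , x) , r) ∷ t) = (x , r) ∷ answersB t

⊨-answers-∷ : ∀ {n k} (A B : Subset n) q r (t : Transcript n k) →
              A ⊨ answersA ((q , r) ∷ t) ∧ B ⊨ answersB ((q , r) ∷ t)
              ≡ does (answer q A B ≟𝔹 r) ∧ A ⊨ answersA t ∧ B ⊨ answersB t
⊨-answers-∷ A B (false , x) r t = ∧-assoc (does (A x ≟𝔹 r)) _ _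
⊨-answers-∷ A B (true  , x) r t = ∧-swap (A ⊨ answersA t) (does (B x ≟𝔹 r)) _

does-run≟ : ∀ {n k} (alg : Algo n k) (A B : Subset n) t →
            does (run alg A B ≟T t) ≡ consistent alg t ∧ A ⊨ answersA t ∧ B ⊨ answersB t
does-run≟ done      A B [] = refl
does-run≟ (ask q f) A B ((q′ , r) ∷ t)
  rewrite does-≟-, {_≟X_ = _≟Q_} {_≟Y_ = _≟𝔹_} (×-≡-dec _≟Q_ _≟𝔹_) q q′ (answer q A B) r
        | ⊨-answers-∷ A B q′ r t
  with q ≟Q q′
... | no _ = refl
... | yes refl with answer q A B ≟𝔹 r
...   | no _     = sym (∧-zeroʳ (consistent (f r) t))
...   | yes refl = does-run≟ (f r) A B t

noCount yesCount : ∀ {n k} → Algo n k → Transcript n k → ℕ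
noCount  {n} alg t = sumℕ (λ A → countL (λ B → does (run alg A B ≟T t)) (allSubset n)) (allSubset n)
yesCount {n} alg t = sumℕ (λ A → countL (λ s → does (run alg A (shift A s) ≟T t)) (allPt n)) (allSubset n)

noCount≡ : ∀ {n k} (alg : Algo n k) t →
           noCount alg t ≡ ⟦ consistent alg t ⟧ * (#Sat n (answersA t) * #Sat n (answersB t))
noCount≡ {n} alg t = begin
  noCount alg t
    ≡⟨ sum-cong (λ A → trans (countL≡sum _ (allSubset n)) (sum-cong (term A) (allSubset n))) (allSubset n) ⟩
  sumℕ (λ A → sumℕ (λ B → (c * ⟦ A ⊨ LA ⟧) * ⟦ B ⊨ LB ⟧) (allSubset n)) (allSubset n)
    ≡⟨ sum-cong (λ A → sum-*ˡ (c * ⟦ A ⊨ LA ⟧) _ (allSubset n)) (allSubset n) ⟩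
  sumℕ (λ A → (c * ⟦ A ⊨ LA ⟧) * #Sat n LB) (allSubset n)
    ≡⟨ sum-*ʳ (#Sat n LB) _ (allSubset n) ⟩
  sumℕ (λ A → c * ⟦ A ⊨ LA ⟧) (allSubset n) * #Sat n LB
    ≡⟨ cong (_* #Sat n LB) (sum-*ˡ c _ (allSubset n)) ⟩
  c * #Sat n LA * #Sat n LB
    ≡⟨ *-assoc c _ _ ⟩
  c * (#Sat n LA * #Sat n LB) ∎
  where
  open ≡-Reasoning
  c  = ⟦ consistent alg t ⟧
  LA = answersA t
  LB = answersB t
  term : ∀ A B → ⟦ does (run alg A B ≟T t) ⟧ ≡ (c * ⟦ A ⊨ LA ⟧) * ⟦ B ⊨ LB ⟧
  term A B = begin
    ⟦ does (run alg A B ≟T t) ⟧            ≡⟨ cong ⟦_⟧ (does-run≟ alg A B t) ⟩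
    ⟦ consistent alg t ∧ A ⊨ LA ∧ B ⊨ LB ⟧  ≡⟨ ⟦∧⟧ (consistent alg t) _ ⟩
    c * ⟦ A ⊨ LA ∧ B ⊨ LB ⟧                 ≡⟨ cong (c *_) (⟦∧⟧ (A ⊨ LA) _) ⟩
    c * (⟦ A ⊨ LA ⟧ * ⟦ B ⊨ LB ⟧)           ≡⟨ *-assoc c _ _ ⟨
    (c * ⟦ A ⊨ LA ⟧) * ⟦ B ⊨ LB ⟧ ∎

yesCount≡ : ∀ {n k} (alg : Algo n k) t →
            yesCount alg t ≡ ⟦ consistent alg t ⟧ * sumℕ (λ s → #Sat n (answersA t ++ translate s (answersB t))) (allPt n)
yesCount≡ {n} alg t = begin
  yesCount alg t
    ≡⟨ sum-cong (λ A → trans (countL≡sum _ (allPt n)) (sum-cong (term A) (allPt n))) (allSubset n) ⟩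
  sumℕ (λ A → sumℕ (λ s → c * ⟦ A ⊨ L s ⟧) (allPt n)) (allSubset n)
    ≡⟨ sum-swap (λ A s → c * ⟦ A ⊨ L s ⟧) (allSubset n) (allPt n) ⟩
  sumℕ (λ s → sumℕ (λ A → c * ⟦ A ⊨ L s ⟧) (allSubset n)) (allPt n)
    ≡⟨ sum-cong (λ s → sum-*ˡ c _ (allSubset n)) (allPt n) ⟩
  sumℕ (λ s → c * #Sat n (L s)) (allPt n)
    ≡⟨ sum-*ˡ c _ (allPt n) ⟩
  c * sumℕ (λ s → #Sat n (L s)) (allPt n) ∎
  where
  open ≡-Reasoning
  c = ⟦ consistent alg t ⟧
  L : Pt n → Constraints n
  L s = answersA t ++ translate s (answersB t)
  term : ∀ A s → ⟦ does (run alg A (shift A s) ≟T t) ⟧ ≡ c * ⟦ A ⊨ L s ⟧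
  term A s = begin
    ⟦ does (run alg A (shift A s) ≟T t) ⟧                          ≡⟨ cong ⟦_⟧ (does-run≟ alg A (shift A s) t) ⟩
    ⟦ consistent alg t ∧ A ⊨ answersA t ∧ shift A s ⊨ answersB t ⟧ ≡⟨ ⟦∧⟧ (consistent alg t) _ ⟩
    c * ⟦ A ⊨ answersA t ∧ shift A s ⊨ answersB t ⟧                ≡⟨ cong (λ b → c * ⟦ A ⊨ answersA t ∧ b ⟧) (⊨-translate A s (answersB t)) ⟩
    c * ⟦ A ⊨ answersA t ∧ A ⊨ translate s (answersB t) ⟧          ≡⟨ cong (λ b → c * ⟦ b ⟧) (⊨-++ A (answersA t) _) ⟨
    c * ⟦ A ⊨ L s ⟧ ∎

Σ-noCount : ∀ {n k} (alg : Algo n k) → sumℕ (noCount alg) (allTranscript n k) ≡ 2 ^ 2 ^ n * 2 ^ 2 ^ n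
Σ-noCount {n} {k} alg =
  trans (sum-fibres (allTranscript-enumerates n k) (run alg) (allSubset n) (allSubset n))
        (cong₂ _*_ (length-allSubset n) (length-allSubset n))

Σ-yesCount : ∀ {n k} (alg : Algo n k) → sumℕ (yesCount alg) (allTranscript n k) ≡ 2 ^ 2 ^ n * 2 ^ n
Σ-yesCount {n} {k} alg =
  trans (sum-fibres (allTranscript-enumerates n k) (λ A s → run alg A (shift A s)) (allSubset n) (allPt n))
        (cong₂ _*_ (length-allSubset n) (length-allPt n))

unique-translation : ∀ n (x y : Pt n) → sumℕ (λ s → ⟦ does (x ≟ₚ y ⊕ s) ⟧) (allPt n) ≡ 1
unique-translation zero    []      []      = refl
unique-translation (suc n) (a ∷ x) (b ∷ y) =
  trans (sum-concatMap-map _∷_ _ (λ c → ⟦ does (a ≟𝔹 b xor c) ⟧) _ (λ c s → ⟦∧⟧ (does (a ≟𝔹 b xor c)) _)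
                           allBool (allPt n))
        (cong₂ _*_ (unique-translation-𝔹 a b) (unique-translation n x y))
  where
  unique-translation-𝔹 : ∀ a b → sumℕ (λ c → ⟦ does (a ≟𝔹 b xor c) ⟧) allBool ≡ 1
  unique-translation-𝔹 false false = refl
  unique-translation-𝔹 false true  = refl
  unique-translation-𝔹 true  false = refl
  unique-translation-𝔹 true  true  = refl

#translates-not-avoiding : ∀ {n} (x : Pt n) L → sumℕ (λ s → ⟦ not (avoids x (translate s L)) ⟧) (allPt n) ≤ length L
#translates-not-avoiding {n} x [] = ≤-reflexive (sum-0 (allPt n))
#translates-not-avoiding {n} x ((y , _) ∷ L) = begin
  sumℕ (λ s → ⟦ not (not (does (x ≟ₚ y ⊕ s)) ∧ avoids x (translate s L)) ⟧) (allPt n)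
    ≤⟨ sum-mono (λ s → ⟦not-∧⟧≤ (not (does (x ≟ₚ y ⊕ s))) _) (allPt n) ⟩
  sumℕ (λ s → ⟦ not (not (does (x ≟ₚ y ⊕ s))) ⟧ + ⟦ not (avoids x (translate s L)) ⟧) (allPt n)
    ≡⟨ sum-+ _ _ (allPt n) ⟩
  sumℕ (λ s → ⟦ not (not (does (x ≟ₚ y ⊕ s))) ⟧) (allPt n)
    + sumℕ (λ s → ⟦ not (avoids x (translate s L)) ⟧) (allPt n)
    ≤⟨ +-mono-≤ (≤-reflexive (trans (sum-cong (λ s → cong ⟦_⟧ (not-involutive _)) (allPt n)) (unique-translation n x y)))
                (#translates-not-avoiding x L) ⟩
  suc (length L) ∎
  where open ≤-Reasoning

#translates-not-disjoint : ∀ {n} (L₁ L₂ : Constraints n) →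
                           sumℕ (λ s → ⟦ not (disjoint L₁ (translate s L₂)) ⟧) (allPt n) ≤ length L₁ * length L₂
#translates-not-disjoint {n} [] L₂ = ≤-reflexive (sum-0 (allPt n))
#translates-not-disjoint {n} ((x , _) ∷ L₁) L₂ = begin
  sumℕ (λ s → ⟦ not (avoids x (translate s L₂) ∧ disjoint L₁ (translate s L₂)) ⟧) (allPt n)
    ≤⟨ sum-mono (λ s → ⟦not-∧⟧≤ (avoids x (translate s L₂)) _) (allPt n) ⟩
  sumℕ (λ s → ⟦ not (avoids x (translate s L₂)) ⟧ + ⟦ not (disjoint L₁ (translate s L₂)) ⟧) (allPt n)
    ≡⟨ sum-+ _ _ (allPt n) ⟩
  sumℕ (λ s → ⟦ not (avoids x (translate s L₂)) ⟧) (allPt n)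
    + sumℕ (λ s → ⟦ not (disjoint L₁ (translate s L₂)) ⟧) (allPt n)
    ≤⟨ +-mono-≤ (#translates-not-avoiding x L₂) (#translates-not-disjoint L₁ L₂) ⟩
  length L₂ + length L₁ * length L₂ ∎
  where open ≤-Reasoning

⟦disjoint⟧*#Sat*#Sat≤#Sat-++ : ∀ n (L₁ L₂ : Constraints n) s →
  ⟦ disjoint L₁ (translate s L₂) ⟧ * (#Sat n L₁ * #Sat n L₂) ≤ #Sat n (L₁ ++ translate s L₂) * 2 ^ 2 ^ n
⟦disjoint⟧*#Sat*#Sat≤#Sat-++ n L₁ L₂ s with disjoint L₁ (translate s L₂) in eq
... | false = z≤n
... | true  = ≤-reflexive (begin
  (#Sat n L₁ * #Sat n L₂) + 0                        ≡⟨ +-identityʳ _ ⟩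
  #Sat n L₁ * #Sat n L₂                              ≡⟨ cong (#Sat n L₁ *_) (#Sat-translate n s L₂) ⟨
  #Sat n L₁ * #Sat n (translate s L₂)                ≡⟨ #Sat-++ n L₁ (translate s L₂) (subst T (sym eq) _) ⟨
  #Sat n (L₁ ++ translate s L₂) * #Sat n []          ≡⟨ cong (#Sat n (L₁ ++ translate s L₂) *_) (#Sat-[] n) ⟩
  #Sat n (L₁ ++ translate s L₂) * 2 ^ 2 ^ n ∎)
  where open ≡-Reasoning

#Sat*#Sat*2ⁿ≤Σ-translates : ∀ n (L₁ L₂ : Constraints n) →
  #Sat n L₁ * #Sat n L₂ * 2 ^ n
    ≤ sumℕ (λ s → #Sat n (L₁ ++ translate s L₂)) (allPt n) * 2 ^ 2 ^ n + #Sat n L₁ * #Sat n L₂ * (length L₁ * length L₂)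
#Sat*#Sat*2ⁿ≤Σ-translates n L₁ L₂ = begin
  P * 2 ^ n
    ≡⟨ cong (P *_) (trans (sym (length-allPt n)) (length≡sum-1 (allPt n))) ⟩
  P * sumℕ (λ _ → 1) (allPt n)
    ≡⟨ cong (P *_) (trans (sum-cong (λ s → sym (⟦b⟧+⟦not-b⟧≡1 (good s))) (allPt n)) (sum-+ _ _ (allPt n))) ⟩
  P * (sumℕ (λ s → ⟦ good s ⟧) (allPt n) + sumℕ (λ s → ⟦ not (good s) ⟧) (allPt n))
    ≡⟨ *-distribˡ-+ P _ _ ⟩
  P * sumℕ (λ s → ⟦ good s ⟧) (allPt n) + P * sumℕ (λ s → ⟦ not (good s) ⟧) (allPt n)
    ≤⟨ +-mono-≤ good-part (*-monoʳ-≤ P (#translates-not-disjoint L₁ L₂)) ⟩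
  sumℕ (λ s → #Sat n (L₁ ++ translate s L₂)) (allPt n) * 2 ^ 2 ^ n + P * (length L₁ * length L₂) ∎
  where
  open ≤-Reasoning
  P = #Sat n L₁ * #Sat n L₂
  good : Pt n → Bool
  good s = disjoint L₁ (translate s L₂)
  good-part : P * sumℕ (λ s → ⟦ good s ⟧) (allPt n) ≤ sumℕ (λ s → #Sat n (L₁ ++ translate s L₂)) (allPt n) * 2 ^ 2 ^ n
  good-part = begin
    P * sumℕ (λ s → ⟦ good s ⟧) (allPt n)       ≡⟨ trans (sum-*ʳ P (λ s → ⟦ good s ⟧) (allPt n)) (*-comm _ P) ⟨
    sumℕ (λ s → ⟦ good s ⟧ * P) (allPt n)       ≤⟨ sum-mono (⟦disjoint⟧*#Sat*#Sat≤#Sat-++ n L₁ L₂) (allPt n) ⟩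
    sumℕ (λ s → #Sat n (L₁ ++ translate s L₂) * 2 ^ 2 ^ n) (allPt n) ≡⟨ sum-*ʳ (2 ^ 2 ^ n) _ (allPt n) ⟩
    sumℕ (λ s → #Sat n (L₁ ++ translate s L₂)) (allPt n) * 2 ^ 2 ^ n ∎

length-answersA : ∀ {n k} (t : Transcript n k) → length (answersA t) ≤ k
length-answersA []                       = z≤n
length-answersA (((false , _) , _) ∷ t) = s≤s (length-answersA t)
length-answersA (((true  , _) , _) ∷ t) = m≤n⇒m≤1+n (length-answersA t)

length-answersB : ∀ {n k} (t : Transcript n k) → length (answersB t) ≤ k
length-answersB []                       = z≤n
length-answersB (((false , _) , _) ∷ t) = m≤n⇒m≤1+n (length-answersB t)
length-answersB (((true  , _) , _) ∷ t) = s≤s (length-answersB t)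

-- Pr_no[t]·(1 − k²/2ⁿ) ≤ Pr_yes[t], with the denominators cleared.
noCount≤yesCount : ∀ {n k} (alg : Algo n k) t →
                   noCount alg t * 2 ^ n ≤ yesCount alg t * 2 ^ 2 ^ n + k * k * noCount alg t
noCount≤yesCount {n} {k} alg t rewrite noCount≡ alg t | yesCount≡ alg t = begin
  c * P * 2 ^ n
    ≡⟨ *-assoc c P _ ⟩
  c * (P * 2 ^ n)
    ≤⟨ *-monoʳ-≤ c (≤-trans (#Sat*#Sat*2ⁿ≤Σ-translates n (answersA t) (answersB t))
                            (+-monoʳ-≤ (S * 2 ^ 2 ^ n) (*-monoʳ-≤ P (*-mono-≤ (length-answersA t) (length-answersB t))))) ⟩
  c * (S * 2 ^ 2 ^ n + P * (k * k))
    ≡⟨ solve 5 (λ c S Z P kk → c :* (S :* Z :+ P :* kk) := c :* S :* Z :+ kk :* (c :* P)) refl c S (2 ^ 2 ^ n) P (k * k) ⟩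
  c * S * 2 ^ 2 ^ n + k * k * (c * P) ∎
  where
  open ≤-Reasoning
  c = ⟦ consistent alg t ⟧
  P = #Sat n (answersA t) * #Sat n (answersB t)
  S = sumℕ (λ s → #Sat n (answersA t ++ translate s (answersB t))) (allPt n)

m∸n+n≡n∸m+m : ∀ m n → (m ∸ n) + n ≡ (n ∸ m) + m
m∸n+n≡n∸m+m zero    zero    = refl
m∸n+n≡n∸m+m zero    (suc n) = sym (+-identityʳ (suc n))
m∸n+n≡n∸m+m (suc m) zero    = +-identityʳ (suc m)
m∸n+n≡n∸m+m (suc m) (suc n) = trans (+-suc (m ∸ n) n) (trans (cong suc (m∸n+n≡n∸m+m m n)) (sym (+-suc (n ∸ m) m)))

∣m-n∣≡m∸n+n∸m : ∀ m n → ∣ m - n ∣ ≡ (m ∸ n) + (n ∸ m)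
∣m-n∣≡m∸n+n∸m zero    zero    = refl
∣m-n∣≡m∸n+n∸m zero    (suc n) = refl
∣m-n∣≡m∸n+n∸m (suc m) zero    = sym (+-identityʳ (suc m))
∣m-n∣≡m∸n+n∸m (suc m) (suc n) = ∣m-n∣≡m∸n+n∸m m n

Σ∣-∣≤ : ∀ {X : Set} (a b c : X → ℕ) xs → sumℕ a xs ≡ sumℕ b xs → (∀ x → b x ≤ a x + c x) →
        sumℕ (λ x → ∣ a x - b x ∣) xs ≤ 2 * sumℕ c xs
Σ∣-∣≤ a b c xs Σa≡Σb b≤a+c = begin
  sumℕ (λ x → ∣ a x - b x ∣) xs
    ≡⟨ trans (sum-cong (λ x → ∣m-n∣≡m∸n+n∸m (a x) (b x)) xs) (sum-+ _ _ xs) ⟩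
  sumℕ a∸b xs + sumℕ b∸a xs
    ≡⟨ cong (_+ sumℕ b∸a xs) Σa∸b≡Σb∸a ⟩
  sumℕ b∸a xs + sumℕ b∸a xs
    ≡⟨ cong (_+_ (sumℕ b∸a xs)) (+-identityʳ _) ⟨
  2 * sumℕ b∸a xs
    ≤⟨ *-monoʳ-≤ 2 (sum-mono (λ x → m≤n+o⇒m∸n≤o (b x) (a x) (b≤a+c x)) xs) ⟩
  2 * sumℕ c xs ∎
  where
  open ≤-Reasoning
  a∸b b∸a : _ → ℕ
  a∸b x = a x ∸ b x
  b∸a x = b x ∸ a x
  Σa∸b≡Σb∸a : sumℕ a∸b xs ≡ sumℕ b∸a xs
  Σa∸b≡Σb∸a = +-cancelʳ-≡ (sumℕ b xs) _ _ (begin-equality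
    sumℕ a∸b xs + sumℕ b xs           ≡⟨ sum-+ a∸b b xs ⟨
    sumℕ (λ x → a∸b x + b x) xs       ≡⟨ sum-cong (λ x → m∸n+n≡n∸m+m (a x) (b x)) xs ⟩
    sumℕ (λ x → b∸a x + a x) xs       ≡⟨ sum-+ b∸a a xs ⟩
    sumℕ b∸a xs + sumℕ a xs           ≡⟨ cong (_+_ (sumℕ b∸a xs)) Σa≡Σb ⟩
    sumℕ b∸a xs + sumℕ b xs ∎)

toℚᵘ-/ : ∀ i d → toℚᵘ (i / suc d) ℚᵘ.≃ mkℚᵘ i d
toℚᵘ-/ i d = ℚ.toℚᵘ-fromℚᵘ (mkℚᵘ i d)

/-rescale : ∀ a b p q .{{_ : NonZero p}} .{{_ : NonZero q}} → a * q ≡ b * p → + a / p ≡ + b / q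
/-rescale a b (suc p) (suc q) aq≡bp =
  ℚ.fromℚᵘ-cong {mkℚᵘ (+ a) p} {mkℚᵘ (+ b) q}
    (*≡* (trans (sym (ℤ.pos-* a (suc q))) (trans (cong +_ aq≡bp) (ℤ.pos-* b (suc p)))))

+-mkℚᵘ : ∀ i j d → mkℚᵘ i d ℚᵘ.+ mkℚᵘ j d ℚᵘ.≃ mkℚᵘ (i ℤ.+ j) d
+-mkℚᵘ i j d = *≡* (begin
  (i ℤ.* D ℤ.+ j ℤ.* D) ℤ.* D   ≡⟨ cong (ℤ._* D) (ℤ.*-distribʳ-+ D i j) ⟨
  (i ℤ.+ j) ℤ.* D ℤ.* D         ≡⟨ ℤ.*-assoc (i ℤ.+ j) D D ⟩
  (i ℤ.+ j) ℤ.* (D ℤ.* D)       ≡⟨ cong ((i ℤ.+ j) ℤ.*_) (ℤ.pos-* (suc d) (suc d)) ⟨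
  (i ℤ.+ j) ℤ.* + (suc d * suc d) ∎)
  where
  open ≡-Reasoning
  D = + suc d

module _ (d : ℕ) where

  /-+-/ : ∀ i j → i / suc d ℚ.+ j / suc d ≡ (i ℤ.+ j) / suc d
  /-+-/ i j = ℚ.toℚᵘ-injective (begin
    toℚᵘ (i / suc d ℚ.+ j / suc d)         ≈⟨ ℚ.toℚᵘ-homo-+ (i / suc d) (j / suc d) ⟩
    toℚᵘ (i / suc d) ℚᵘ.+ toℚᵘ (j / suc d)  ≈⟨ ℚᵘ.+-cong (toℚᵘ-/ i d) (toℚᵘ-/ j d) ⟩
    mkℚᵘ i d ℚᵘ.+ mkℚᵘ j d                  ≈⟨ +-mkℚᵘ i j d ⟩
    mkℚᵘ (i ℤ.+ j) d                        ≈⟨ toℚᵘ-/ (i ℤ.+ j) d ⟨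
    toℚᵘ ((i ℤ.+ j) / suc d) ∎)
    where open ℚᵘ.≃-Reasoning

  -‿/ : ∀ i → ℚ.- (i / suc d) ≡ (ℤ.- i) / suc d
  -‿/ i = ℚ.toℚᵘ-injective (ℚᵘ.≃-trans (ℚ.toℚᵘ-homo‿- (i / suc d))
                                       (ℚᵘ.≃-trans (ℚᵘ.-‿cong (toℚᵘ-/ i d)) (ℚᵘ.≃-sym (toℚᵘ-/ (ℤ.- i) d))))

  ∣/∣ : ∀ i → ℚ.∣ i / suc d ∣ ≡ + ℤ.∣ i ∣ / suc d
  ∣/∣ i = ℚ.toℚᵘ-injective (ℚᵘ.≃-trans (ℚ.toℚᵘ-homo-∣-∣ (i / suc d))
                                      (ℚᵘ.≃-trans (ℚᵘ.∣-∣-cong (toℚᵘ-/ i d)) (ℚᵘ.≃-sym (toℚᵘ-/ (+ ℤ.∣ i ∣) d))))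

∣m⊖n∣≡∣m-n∣ : ∀ m n → ℤ.∣ m ⊖ n ∣ ≡ ∣ m - n ∣
∣m⊖n∣≡∣m-n∣ zero    zero    = refl
∣m⊖n∣≡∣m-n∣ zero    (suc n) = refl
∣m⊖n∣≡∣m-n∣ (suc m) zero    = refl
∣m⊖n∣≡∣m-n∣ (suc m) (suc n) = trans (cong ℤ.∣_∣ (ℤ.[1+m]⊖[1+n]≡m⊖n m n)) (∣m⊖n∣≡∣m-n∣ m n)

∣/-/∣ : ∀ a b D .{{_ : NonZero D}} → ℚ.∣ + a / D ℚ.- + b / D ∣ ≡ + ∣ a - b ∣ / D
∣/-/∣ a b (suc d) = begin
  ℚ.∣ + a / suc d ℚ.- + b / suc d ∣       ≡⟨ cong (λ q → ℚ.∣ + a / suc d ℚ.+ q ∣) (-‿/ d (+ b)) ⟩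
  ℚ.∣ + a / suc d ℚ.+ ℤ.- + b / suc d ∣   ≡⟨ cong ℚ.∣_∣ (/-+-/ d (+ a) (ℤ.- + b)) ⟩
  ℚ.∣ (+ a ℤ.- + b) / suc d ∣             ≡⟨ ∣/∣ d (+ a ℤ.- + b) ⟩
  + ℤ.∣ + a ℤ.- + b ∣ / suc d             ≡⟨ cong (λ i → + ℤ.∣ i ∣ / suc d) (ℤ.m-n≡m⊖n a b) ⟩
  + ℤ.∣ a ⊖ b ∣ / suc d                   ≡⟨ cong (λ m → + m / suc d) (∣m⊖n∣≡∣m-n∣ a b) ⟩
  + ∣ a - b ∣ / suc d ∎
  where open ≡-Reasoning

Σ∣-∣-common-denominator : ∀ {X : Set} (p q : X → ℚ) (f g : X → ℕ) D .{{_ : NonZero D}} →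
                           (∀ x → p x ≡ + f x / D) → (∀ x → q x ≡ + g x / D) →
                           ∀ xs → sumℚ (λ x → ℚ.∣ p x ℚ.- q x ∣) xs ≡ + sumℕ (λ x → ∣ f x - g x ∣) xs / D
Σ∣-∣-common-denominator p q f g (suc d) p≡ q≡ []       = sym (ℚ.0/n≡0 (suc d))
Σ∣-∣-common-denominator p q f g (suc d) p≡ q≡ (x ∷ xs) = begin
  ℚ.∣ p x ℚ.- q x ∣ ℚ.+ sumℚ (λ x → ℚ.∣ p x ℚ.- q x ∣) xs
    ≡⟨ cong₂ ℚ._+_ (trans (cong₂ (λ a b → ℚ.∣ a ℚ.- b ∣) (p≡ x) (q≡ x)) (∣/-/∣ (f x) (g x) (suc d)))
                   (Σ∣-∣-common-denominator p q f g (suc d) p≡ q≡ xs) ⟩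
  + ∣ f x - g x ∣ / suc d ℚ.+ + sumℕ (λ x → ∣ f x - g x ∣) xs / suc d
    ≡⟨ /-+-/ d (+ ∣ f x - g x ∣) (+ sumℕ (λ x → ∣ f x - g x ∣) xs) ⟩
  (+ ∣ f x - g x ∣ ℤ.+ + sumℕ (λ x → ∣ f x - g x ∣) xs) / suc d
    ≡⟨ cong (_/ suc d) (ℤ.pos-+ ∣ f x - g x ∣ (sumℕ (λ x → ∣ f x - g x ∣) xs)) ⟨
  + sumℕ (λ x → ∣ f x - g x ∣) (x ∷ xs) / suc d ∎
  where open ≡-Reasoning

½*/≤1/50 : ∀ S D .{{_ : NonZero D}} → 25 * S ≤ D → ½ ℚ.* (+ S / D) ≤ℚ + 1 / 50
½*/≤1/50 S (suc d) 25S≤D = ℚ.toℚᵘ-cancel-≤ (begin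
  toℚᵘ (½ ℚ.* (+ S / suc d))
    ≃⟨ ℚᵘ.≃-trans (ℚ.toℚᵘ-homo-* ½ (+ S / suc d)) (ℚᵘ.*-cong (toℚᵘ-/ (+ 1) 1) (toℚᵘ-/ (+ S) d)) ⟩
  mkℚᵘ (+ 1) 1 ℚᵘ.* mkℚᵘ (+ S) d
    ≤⟨ *≤* 50S≤2D ⟩
  mkℚᵘ (+ 1) 49
    ≃⟨ toℚᵘ-/ (+ 1) 49 ⟨
  toℚᵘ (+ 1 / 50) ∎)
  where
  open ℚᵘ.≤-Reasoning
  50S≤2D : + 1 ℤ.* + S ℤ.* + 50 ℤ.≤ + 1 ℤ.* (+ 2 ℤ.* + suc d)
  50S≤2D rewrite ℤ.*-identityˡ (+ S) | ℤ.*-identityˡ (+ 2 ℤ.* + suc d)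
               | sym (ℤ.pos-* S 50) | sym (ℤ.pos-* 2 (suc d)) =
    ℤ.+≤+ (≤-trans (≤-reflexive (trans (*-comm S 50) (*-assoc 2 25 S))) (*-monoʳ-≤ 2 25S≤D))

commonDenominator : ℕ → ℕ
commonDenominator n = 2 ^ 2 ^ n * 2 ^ n * 2 ^ 2 ^ n

commonDenominator-nonZero : ∀ n → NonZero (commonDenominator n)
commonDenominator-nonZero n = m*n≢0 _ _ {{m*n≢0 _ _ {{m^n≢0 2 (2 ^ n)}} {{m^n≢0 2 n}}}} {{m^n≢0 2 (2 ^ n)}}

module _ {n k} (alg : Algo n k) where

  private
    instance
      _ = commonDenominator-nonZero n
    Z M : ℕ
    Z = 2 ^ 2 ^ n
    M = 2 ^ n

  discrepancy : ℕ
  discrepancy = sumℕ (λ t → ∣ yesCount alg t * Z - noCount alg t * M ∣) (allTranscript n k)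

  distTV≡discrepancy : distTV-transcript alg ≡ ½ ℚ.* (+ discrepancy / commonDenominator n)
  distTV≡discrepancy = cong (½ ℚ.*_) (Σ∣-∣-common-denominator (probYes alg) (probNo alg)
    (λ t → yesCount alg t * Z) (λ t → noCount alg t * M) (commonDenominator n) yes≡ no≡ (allTranscript n k))
    where
    open ≡-Reasoning
    yes≡ : ∀ t → probYes alg t ≡ + (yesCount alg t * Z) / commonDenominator n
    yes≡ t = /-rescale y (y * Z) (2 ^ (2 ^ n + n)) (commonDenominator n) {{m^n≢0 2 (2 ^ n + n)}} (begin
      y * (Z * M * Z)        ≡⟨ solve 3 (λ y z m → y :* (z :* m :* z) := y :* z :* (z :* m)) refl y Z M ⟩
      y * Z * (Z * M)        ≡⟨ cong (y * Z *_) (^-distribˡ-+-* 2 (2 ^ n) n) ⟨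
      y * Z * 2 ^ (2 ^ n + n) ∎)
      where y = yesCount alg t
    no≡ : ∀ t → probNo alg t ≡ + (noCount alg t * M) / commonDenominator n
    no≡ t = /-rescale x (x * M) (2 ^ (2 ^ n + 2 ^ n)) (commonDenominator n) {{m^n≢0 2 (2 ^ n + 2 ^ n)}} (begin
      x * (Z * M * Z)        ≡⟨ solve 3 (λ x z m → x :* (z :* m :* z) := x :* m :* (z :* z)) refl x Z M ⟩
      x * M * (Z * Z)        ≡⟨ cong (x * M *_) (^-distribˡ-+-* 2 (2 ^ n) (2 ^ n)) ⟨
      x * M * 2 ^ (2 ^ n + 2 ^ n) ∎)
      where x = noCount alg t

  discrepancy≤ : discrepancy ≤ 2 * (k * k * (Z * Z))
  discrepancy≤ = begin
    discrepancy
      ≤⟨ Σ∣-∣≤ (λ t → yesCount alg t * Z) (λ t → noCount alg t * M) (λ t → k * k * noCount alg t)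
               (allTranscript n k) balanced (noCount≤yesCount alg) ⟩
    2 * sumℕ (λ t → k * k * noCount alg t) (allTranscript n k)
      ≡⟨ cong (2 *_) (trans (sum-*ˡ (k * k) (noCount alg) (allTranscript n k)) (cong (k * k *_) (Σ-noCount alg))) ⟩
    2 * (k * k * (Z * Z)) ∎
    where
    open ≤-Reasoning
    balanced : sumℕ (λ t → yesCount alg t * Z) (allTranscript n k) ≡ sumℕ (λ t → noCount alg t * M) (allTranscript n k)
    balanced = begin-equality
      sumℕ (λ t → yesCount alg t * Z) (allTranscript n k) ≡⟨ sum-*ʳ Z (yesCount alg) (allTranscript n k) ⟩
      sumℕ (yesCount alg) (allTranscript n k) * Z          ≡⟨ cong (_* Z) (Σ-yesCount alg) ⟩
      Z * M * Z                                            ≡⟨ solve 2 (λ z m → z :* m :* z := z :* z :* m) refl Z M ⟩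
      Z * Z * M                                            ≡⟨ cong (_* M) (Σ-noCount alg) ⟨
      sumℕ (noCount alg) (allTranscript n k) * M           ≡⟨ sum-*ʳ M (noCount alg) (allTranscript n k) ⟨
      sumℕ (λ t → noCount alg t * M) (allTranscript n k) ∎

  25*discrepancy≤commonDenominator : 100 * (k * k) ≤ 2 ^ n → 25 * discrepancy ≤ commonDenominator n
  25*discrepancy≤commonDenominator 100k²≤2ⁿ = begin
    25 * discrepancy              ≤⟨ *-monoʳ-≤ 25 discrepancy≤ ⟩
    25 * (2 * (k * k * (Z * Z)))  ≡⟨ solve 2 (λ kk zz → con 25 :* (con 2 :* (kk :* zz)) := con 50 :* kk :* zz) refl (k * k) (Z * Z) ⟩
    50 * (k * k) * (Z * Z)        ≤⟨ *-monoˡ-≤ (Z * Z) (≤-trans (*-monoˡ-≤ (k * k) (m≤n*m 50 2)) 100k²≤2ⁿ) ⟩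
    M * (Z * Z)                   ≡⟨ solve 2 (λ m z → m :* (z :* z) := z :* m :* z) refl M Z ⟩
    commonDenominator n ∎
    where open ≤-Reasoning

claim3p5 : (n N : ℕ) → 100 * (N * N) ≤ 2 ^ n →
    2 ^ n < 100 * (suc N * suc N) → (Test : Algo n N) →
    distTV-transcript Test ≤ℚ (+ 1 / 50)
claim3p5 n N 100N²≤2ⁿ _ Test = begin
  distTV-transcript Test                               ≡⟨ distTV≡discrepancy Test ⟩
  ½ ℚ.* (+ discrepancy Test / commonDenominator n)     ≤⟨ ½*/≤1/50 (discrepancy Test) (commonDenominator n)
                                                            (25*discrepancy≤commonDenominator Test 100N²≤2ⁿ) ⟩
  + 1 / 50 ∎
  where
  open ℚ.≤-Reasoning
  instance
    _ = commonDenominator-nonZero n
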